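{- For all integers $s \ge 1$ and $t \ge 1$, exactly one linear extension of $EN_{s,t}$ avoids the pattern $213$; that is, $|EN_{s,t}(213)| = 1$.
   Context: For positive integers $s,t$, write each $x \in [st]=\{1,\dots,st\}$ uniquely as $x=(j-1)t+r$ with $1\le j\le s$ and $1\le r\le t$. The poset $EN_{s,t}$ is $[st]$ with the partial order $(j-1)t+r \preceq (j'-1)t+r'$ if and only if $j'\le j$ and $r\le r'$. A linear extension of a poset $([n],\preceq)$ is a permutation $\pi=\pi(1)\pi(2)\cdots\pi(n)$ of $[n]$ (one-line notation) such that whenever $a\preceq b$ and $a\ne b$, the entry $a$ appears before $b$ in $\pi$. A permutation $\pi$ contains a permutation $\sigma$ if $\pi$ has a subsequence with the same relative order as $\sigma$, and avoids $\sigma$ otherwise. For a poset $P$ on $[n]$, $P(\sigma_1,\dots,\sigma_k)$ denotes the set of linear extensions of $P$ avoiding each of $\sigma_1,\dots,\sigma_k$. -}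

module Defs where

open import Data.Nat using (ℕ; zero; suc; _+_; _*_; _∸_; _≤_; _<_)
open import Data.Nat.DivMod using (_/_; _%_)
open import Data.List using (List; length; lookup; map)
open import Data.List.Relation.Binary.Permutation.Propositional using (_↭_)
open import Data.Fin using (Fin; toℕ) renaming (_<_ to _<ᶠ_)
open import Data.Product using (Σ; _×_; ∃-syntax; _,_)
open import Relation.Binary.PropositionalEquality using (_≡_)
open import Relation.Nullary using (¬_)

range1 : ℕ → List ℕ
range1 zero = Data.List.[]
range1 (suc n) = 1 Data.List.∷ map suc (range1 n)

IsPerm : ℕ → List ℕ → Set
IsPerm n π = π ↭ range1 n

EN≼ : (s t : ℕ) → ℕ → ℕ → Set
EN≼ s t x y =
  Σ ℕ λ j → Σ ℕ λ r → Σ ℕ λ j' → Σ ℕ λ r' →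
    (1 ≤ j × j ≤ s × 1 ≤ r × r ≤ t × 1 ≤ j' × j' ≤ s × 1 ≤ r' × r' ≤ t) ×
    (x ≡ (j ∸ 1) * t + r) × (y ≡ (j' ∸ 1) * t + r') ×
    (j' ≤ j × r ≤ r')

AppearsBefore : List ℕ → ℕ → ℕ → Set
AppearsBefore π a b =
  Σ (Fin (length π)) λ i → Σ (Fin (length π)) λ k →
    i <ᶠ k × lookup π i ≡ a × lookup π k ≡ b

IsLinearExtension : (n : ℕ) → (ℕ → ℕ → Set) → List ℕ → Set
IsLinearExtension n _≼_ π =
  IsPerm n π × (∀ a b → a ≼ b → ¬ (a ≡ b) → AppearsBefore π a b)

Contains213 : List ℕ → Set
Contains213 π =
  Σ (Fin (length π)) λ i → Σ (Fin (length π)) λ j → Σ (Fin (length π)) λ k →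
    i <ᶠ j × j <ᶠ k ×
    lookup π j < lookup π i × lookup π i < lookup π k

Avoids213 : List ℕ → Set
Avoids213 π = ¬ Contains213 π

EN213 : ℕ → ℕ → List ℕ → Set
EN213 s t π = IsLinearExtension (s * t) (EN≼ s t) π × Avoids213 π

-- Read EN_{s,t} as an s × t grid whose j-th row (from the bottom) is the interval
-- ((j-1)t, jt].  The unique 213-avoiding linear extension is the reading word
-- "top row first, each row left to right": it is sorted by the strict total order
-- ◁ that compares rows downwards and then values upwards.  Conversely, let σ be
-- a 213-avoiding linear extension and a ◁ b.  In the same row a ≼ b.  If b lies
-- in a lower row, the first cell x of a's row satisfies x ≼ b, so x precedes b,
-- while b < x ≤ a; were a after b, the entries x, b, a would form a 213.  Hence
-- σ is ◁-sorted as well, and a permutation sorted by a strict total order is unique.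
module Submission where

open import Defs
open import Data.Nat using (ℕ; zero; suc; _+_; _*_; _∸_; _≤_; _<_; _>_; z≤n; s≤s; NonZero; >-nonZero⁻¹)
open import Data.Nat.Properties
open import Data.Nat.DivMod using (_/_; _%_; m≡m%n+[m/n]*n; +-distrib-/-∣ˡ; m*n/n≡m; m<n⇒m/n≡0; m%n<n; m<n*o⇒m/o<n; /-monoˡ-≤)
open import Data.Nat.Divisibility using (n∣m*n)
open import Data.List using (List; []; _∷_; _++_; map; lookup)
open import Data.List.Properties using (map-++; map-∘; map-id)
open import Data.List.Relation.Unary.All as All using (All; []; _∷_)
open import Data.List.Relation.Unary.AllPairs as AllPairs using (AllPairs; []; _∷_)
import Data.List.Relation.Unary.AllPairs.Properties as AllPairs
open import Data.List.Relation.Unary.Any as Any using (here; there)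
open import Data.List.Relation.Unary.Any.Properties using (lookup-index)
open import Data.List.Relation.Unary.Unique.Propositional using (Unique)
open import Data.List.Membership.Propositional using (_∈_)
open import Data.List.Membership.Propositional.Properties using (∈-map⁺; ∈-map⁻; ∈-++⁻; ∈-lookup)
open import Data.List.Relation.Binary.Permutation.Propositional using (_↭_; ↭-refl; ↭-sym; ↭-trans; ↭-reflexive; ↭⇒↭ₛ)
open import Data.List.Relation.Binary.Permutation.Propositional.Properties using (∈-resp-↭; drop-∷; ++-comm; ++⁺ʳ; ¬x∷xs↭[])
import Data.List.Relation.Binary.Permutation.Setoid.Properties as Permutationₛ
open import Data.Fin using (Fin) renaming (zero to fzero; suc to fsuc; _<_ to _<ᶠ_)
import Data.Fin.Properties as Fin
open import Data.Product using (Σ; _×_; _,_; proj₁; proj₂)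
open import Data.Product.Relation.Binary.Lex.Strict using (×-Lex; ×-compare)
open import Data.Sum using (_⊎_; inj₁; inj₂)
open import Data.Empty using (⊥-elim)
open import Relation.Binary using (Trichotomous; Irreflexive; Asymmetric; tri<; tri≈; tri>)
open import Relation.Binary.Consequences using (tri⇒irr; tri⇒asym)
import Relation.Binary.Construct.Flip.EqAndOrd as Flip
open import Relation.Binary.PropositionalEquality

index-before-or-after : ∀ {xs : List ℕ} {a} (a∈ : a ∈ xs) k → a ≢ lookup xs k →
                        Any.index a∈ <ᶠ k ⊎ k <ᶠ Any.index a∈
index-before-or-after {xs} a∈ k a≢xsₖ with Fin.<-cmp (Any.index a∈) k
... | tri< a<k _ _ = inj₁ a<k
... | tri≈ _ a≡k _ = ⊥-elim (a≢xsₖ (trans (lookup-index a∈) (cong (lookup xs) a≡k)))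
... | tri> _ _ k<a = inj₂ k<a

allPairs-mapWithAll : ∀ {A : Set} {P : A → Set} {R S : A → A → Set} →
                      (∀ {x y} → P x → P y → R x y → S x y) →
                      ∀ {xs} → All P xs → AllPairs R xs → AllPairs S xs
allPairs-mapWithAll f [] [] = []
allPairs-mapWithAll f (px ∷ pxs) (rx ∷ rxs) =
  All.zipWith (λ (py , r) → f px py r) (pxs , rx) ∷ allPairs-mapWithAll f pxs rxs

module OrderedBy {_◁_ : ℕ → ℕ → Set} (compare : Trichotomous _≡_ _◁_) where

  ◁-irrefl : Irreflexive _≡_ _◁_
  ◁-irrefl = tri⇒irr compare

  ◁-asym : Asymmetric _◁_
  ◁-asym = tri⇒asym compare

  lookup-sorted : ∀ {xs} → AllPairs _◁_ xs → ∀ {i k} → i <ᶠ k → lookup xs i ◁ lookup xs k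
  lookup-sorted {x ∷ xs} (x◁xs ∷ _) {fzero} {fsuc k} _ = All.lookup x◁xs (∈-lookup k)
  lookup-sorted {x ∷ xs} (_ ∷ sorted) {fsuc i} {fsuc k} (s≤s i<k) = lookup-sorted sorted i<k

  sorted⇒appearsBefore : ∀ {xs a b} → AllPairs _◁_ xs → a ∈ xs → b ∈ xs → a ◁ b →
                         AppearsBefore xs a b
  sorted⇒appearsBefore sorted a∈ b∈ a◁b
    with index-before-or-after a∈ (Any.index b∈)
           (λ a≡ → ◁-irrefl (trans a≡ (sym (lookup-index b∈))) a◁b)
  ... | inj₁ a<b = _ , _ , a<b , sym (lookup-index a∈) , sym (lookup-index b∈)
  ... | inj₂ b<a = ⊥-elim (◁-asym a◁b (subst₂ _◁_ (sym (lookup-index b∈)) (sym (lookup-index a∈))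
                                                  (lookup-sorted sorted b<a)))

  RespectsOrder : List ℕ → Set
  RespectsOrder σ = ∀ {a b} → a ∈ σ → b ∈ σ → a ◁ b → AppearsBefore σ a b

  respectsOrder⇒sorted : ∀ {σ} → Unique σ → RespectsOrder σ → AllPairs _◁_ σ
  respectsOrder⇒sorted {[]} [] _ = []
  respectsOrder⇒sorted {x ∷ xs} (x∉xs ∷ unique) respects =
    All.tabulate x◁ ∷ respectsOrder⇒sorted unique respects-tail
    where
    x◁ : ∀ {y} → y ∈ xs → x ◁ y
    x◁ {y} y∈ with compare x y
    ... | tri< x◁y _ _ = x◁y
    ... | tri≈ _ x≡y _ = ⊥-elim (All.lookup x∉xs y∈ x≡y)
    ... | tri> _ _ y◁x with respects (there y∈) (here refl) y◁x
    ...   | _ , fsuc k , _ , _ , xsₖ≡x =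
      ⊥-elim (All.lookup x∉xs (subst (_∈ xs) xsₖ≡x (∈-lookup k)) refl)

    respects-tail : RespectsOrder xs
    respects-tail a∈ b∈ a◁b with respects (there a∈) (there b∈) a◁b
    ... | fzero , _ , _ , x≡a , _ = ⊥-elim (All.lookup x∉xs (subst (_∈ xs) (sym x≡a) a∈) refl)
    ... | fsuc i , fsuc k , s≤s i<k , xsᵢ≡a , xsₖ≡b = i , k , i<k , xsᵢ≡a , xsₖ≡b

  sorted-↭⇒≡ : ∀ {xs ys} → xs ↭ ys → AllPairs _◁_ xs → AllPairs _◁_ ys → xs ≡ ys
  sorted-↭⇒≡ {[]} {[]} _ _ _ = refl
  sorted-↭⇒≡ {[]} {y ∷ ys} p _ _ = ⊥-elim (¬x∷xs↭[] (↭-sym p))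
  sorted-↭⇒≡ {x ∷ xs} {[]} p _ _ = ⊥-elim (¬x∷xs↭[] p)
  sorted-↭⇒≡ {x ∷ xs} {y ∷ ys} p (x◁xs ∷ xs-sorted) (y◁ys ∷ ys-sorted) =
    cong₂ _∷_ x≡y
      (sorted-↭⇒≡ (drop-∷ (subst (λ z → z ∷ xs ↭ y ∷ ys) x≡y p)) xs-sorted ys-sorted)
    where
    x≡y : x ≡ y
    x≡y with ∈-resp-↭ p (here {xs = xs} refl) | ∈-resp-↭ (↭-sym p) (here {xs = ys} refl)
    ... | here x≡y | _ = x≡y
    ... | there _ | here y≡x = sym y≡x
    ... | there x∈ys | there y∈xs = ⊥-elim (◁-asym (All.lookup x◁xs y∈xs) (All.lookup y◁ys x∈ys))

∈-range1⁻ : ∀ {x} n → x ∈ range1 n → 1 ≤ x × x ≤ n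
∈-range1⁻ (suc n) (here refl) = s≤s z≤n , s≤s z≤n
∈-range1⁻ (suc n) (there x∈) with ∈-map⁻ suc x∈
... | y , y∈ , refl = s≤s z≤n , s≤s (proj₂ (∈-range1⁻ n y∈))

∈-range1⁺ : ∀ {x} n → 1 ≤ x → x ≤ n → x ∈ range1 n
∈-range1⁺ {suc zero} (suc n) _ _ = here refl
∈-range1⁺ {suc (suc x)} (suc n) _ (s≤s x<n) = there (∈-map⁺ suc (∈-range1⁺ n (s≤s z≤n) x<n))

range1-increasing : ∀ n → AllPairs _<_ (range1 n)
range1-increasing zero = []
range1-increasing (suc n) = All.tabulate 1< ∷ AllPairs.map⁺ (AllPairs.map s≤s (range1-increasing n))
  where
  1< : ∀ {y} → y ∈ map suc (range1 n) → 1 < y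
  1< y∈ with ∈-map⁻ suc y∈
  ... | z , z∈ , refl = s≤s (proj₁ (∈-range1⁻ n z∈))

range1-unique : ∀ n → Unique (range1 n)
range1-unique n = AllPairs.map <⇒≢ (range1-increasing n)

range1-+ : ∀ m n → range1 (m + n) ≡ range1 m ++ map (m +_) (range1 n)
range1-+ zero n = sym (map-id _)
range1-+ (suc m) n = cong (1 ∷_) (begin
    map suc (range1 (m + n))
  ≡⟨ cong (map suc) (range1-+ m n) ⟩
    map suc (range1 m ++ map (m +_) (range1 n))
  ≡⟨ map-++ suc (range1 m) _ ⟩
    map suc (range1 m) ++ map suc (map (m +_) (range1 n))
  ≡⟨ cong (map suc (range1 m) ++_) (map-∘ (range1 n)) ⟨
    map suc (range1 m) ++ map (suc m +_) (range1 n) ∎)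
  where open ≡-Reasoning

↭-unique : ∀ {xs ys : List ℕ} → xs ↭ ys → Unique xs → Unique ys
↭-unique p = Permutationₛ.Unique-resp-↭ (setoid ℕ) (↭⇒↭ₛ p)

avoids213⇒appearsBefore : ∀ {σ x a b} → Avoids213 σ → AppearsBefore σ x b → b < x → x ≤ a → a ∈ σ →
                          AppearsBefore σ a b
avoids213⇒appearsBefore avoids x-before-b@(i , k , i<k , σᵢ≡x , σₖ≡b) b<x x≤a a∈
  with m≤n⇒m<n∨m≡n x≤a
... | inj₂ refl = x-before-b
... | inj₁ x<a
  with index-before-or-after a∈ k (λ a≡σₖ → <-irrefl (sym (trans a≡σₖ σₖ≡b)) (<-trans b<x x<a))
...   | inj₁ a<k = Any.index a∈ , k , a<k , sym (lookup-index a∈) , σₖ≡b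
...   | inj₂ k<a = ⊥-elim (avoids (i , k , Any.index a∈ , i<k , k<a ,
                                    subst₂ _<_ (sym σₖ≡b) (sym σᵢ≡x) b<x ,
                                    subst₂ _<_ (sym σᵢ≡x) (lookup-index a∈) x<a))

-- Cells are numbered from 0: x = row x * t + col x + 1, so the paper's (j, r) is (row x + 1, col x + 1).
module Grid (s t : ℕ) .{{_ : NonZero t}} where

  row col : ℕ → ℕ
  row x = (x ∸ 1) / t
  col x = (x ∸ 1) % t

  row-cell : ∀ q {c} → c < t → row (q * t + suc c) ≡ q
  row-cell q {c} c<t = begin
      (q * t + suc c ∸ 1) / t     ≡⟨ cong (λ n → (n ∸ 1) / t) (+-suc (q * t) c) ⟩
      (q * t + c) / t             ≡⟨ +-distrib-/-∣ˡ c (n∣m*n q) ⟩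
      q * t / t + c / t           ≡⟨ cong₂ _+_ (m*n/n≡m q t) (m<n⇒m/n≡0 c<t) ⟩
      q + 0                       ≡⟨ +-identityʳ q ⟩
      q                           ∎
    where open ≡-Reasoning

  cell-row-col : ∀ {x} → x ∈ range1 (s * t) → x ≡ row x * t + suc (col x)
  cell-row-col x∈ with ∈-range1⁻ (s * t) x∈
  ... | s≤s {n = y} z≤n , _ = begin
      suc y                         ≡⟨ cong suc (m≡m%n+[m/n]*n y t) ⟩
      suc (y % t + y / t * t)       ≡⟨ cong suc (+-comm (y % t) (y / t * t)) ⟩
      suc (y / t * t + y % t)       ≡⟨ +-suc (y / t * t) (y % t) ⟨
      y / t * t + suc (y % t)       ∎
    where open ≡-Reasoning

  col<t : ∀ x → col x < t
  col<t x = m%n<n (x ∸ 1) t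

  row<s : ∀ {x} → x ∈ range1 (s * t) → row x < s
  row<s x∈ with ∈-range1⁻ (s * t) x∈
  ... | s≤s z≤n , x≤st = m<n*o⇒m/o<n x≤st

  row-mono : ∀ {x y} → x ≤ y → row x ≤ row y
  row-mono x≤y = /-monoˡ-≤ t (∸-monoˡ-≤ 1 x≤y)

  m*t+e≤n*t : ∀ {m n e} → m < n → e ≤ t → m * t + e ≤ n * t
  m*t+e≤n*t {m} m<n e≤t =
    ≤-trans (+-monoʳ-≤ (m * t) e≤t) (≤-trans (≤-reflexive (+-comm (m * t) t)) (*-monoˡ-≤ t m<n))

  cell∈range : ∀ {j c} → j < s → c < t → j * t + suc c ∈ range1 (s * t)
  cell∈range {j} {c} j<s c<t =
    ∈-range1⁺ (s * t) (≤-trans (s≤s z≤n) (m≤n+m (suc c) (j * t))) (m*t+e≤n*t j<s c<t)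

  cell-≼ : ∀ {j c j' c'} → j < s → c < t → j' < s → c' < t → j' ≤ j → c ≤ c' →
           EN≼ s t (j * t + suc c) (j' * t + suc c')
  cell-≼ {j} {c} {j'} {c'} j<s c<t j'<s c'<t j'≤j c≤c' =
    suc j , suc c , suc j' , suc c' ,
    (s≤s z≤n , j<s , s≤s z≤n , c<t , s≤s z≤n , j'<s , s≤s z≤n , c'<t) ,
    refl , refl , s≤s j'≤j , s≤s c≤c'

  sameRow-≼ : ∀ {a b} → a ∈ range1 (s * t) → b ∈ range1 (s * t) → row a ≡ row b → a < b →
              EN≼ s t a b
  sameRow-≼ {a} {b} a∈ b∈ ra≡rb a<b =
    subst₂ (EN≼ s t) (sym a≡) (sym b≡)
      (cell-≼ (row<s a∈) (col<t a) (row<s a∈) (col<t b) ≤-refl col-a≤col-b)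
    where
    a≡ : a ≡ row a * t + suc (col a)
    a≡ = cell-row-col a∈
    b≡ : b ≡ row a * t + suc (col b)
    b≡ = trans (cell-row-col b∈) (cong (λ r → r * t + suc (col b)) (sym ra≡rb))
    col-a≤col-b : col a ≤ col b
    col-a≤col-b = ≮⇒≥ λ col-b<col-a →
      <-asym a<b (subst₂ _<_ (sym b≡) (sym a≡) (+-monoʳ-< (row a * t) (s≤s col-b<col-a)))

  rowStart-≼ : ∀ {a b} → a ∈ range1 (s * t) → b ∈ range1 (s * t) → row b < row a →
               EN≼ s t (row a * t + 1) b
  rowStart-≼ {a} {b} a∈ b∈ rb<ra =
    subst (EN≼ s t (row a * t + 1)) (sym (cell-row-col b∈))
      (cell-≼ (row<s a∈) (>-nonZero⁻¹ t) (row<s b∈) (col<t b) (<⇒≤ rb<ra) z≤n)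

  _◁_ : ℕ → ℕ → Set
  a ◁ b = ×-Lex _≡_ _>_ _<_ (row a , a) (row b , b)

  ◁-compare : Trichotomous _≡_ _◁_
  ◁-compare a b with ×-compare sym (Flip.compare _<_ <-cmp) <-cmp (row a , a) (row b , b)
  ... | tri< a◁b a≉b b◁̸a = tri< a◁b (λ a≡b → a≉b (cong row a≡b , a≡b)) b◁̸a
  ... | tri≈ a◁̸b (_ , a≡b) b◁̸a = tri≈ a◁̸b a≡b b◁̸a
  ... | tri> a◁̸b a≉b b◁a = tri> a◁̸b (λ a≡b → a≉b (cong row a≡b , a≡b)) b◁a

  open OrderedBy ◁-compare

  ◁⇒row≥ : ∀ {a b} → a ◁ b → row b ≤ row a
  ◁⇒row≥ (inj₁ rb<ra) = <⇒≤ rb<ra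
  ◁⇒row≥ (inj₂ (ra≡rb , _)) = ≤-reflexive (sym ra≡rb)

  ◁-downwards : ∀ {a b} → a ◁ b → b < a → row b < row a
  ◁-downwards (inj₁ rb<ra) _ = rb<ra
  ◁-downwards (inj₂ (_ , a<b)) b<a = ⊥-elim (<-asym a<b b<a)

  ≼⇒◁ : ∀ {a b} → EN≼ s t a b → a ≢ b → a ◁ b
  ≼⇒◁ (suc j , suc c , suc j' , suc c' , (_ , _ , _ , c<t , _ , _ , _ , c'<t) ,
       refl , refl , s≤s j'≤j , s≤s c≤c') a≢b
    with m≤n⇒m<n∨m≡n j'≤j
  ... | inj₁ j'<j = inj₁ (subst₂ _<_ (sym (row-cell j' c'<t)) (sym (row-cell j c<t)) j'<j)
  ... | inj₂ refl with m≤n⇒m<n∨m≡n c≤c'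
  ...   | inj₁ c<c' = inj₂ (trans (row-cell j c<t) (sym (row-cell j c'<t)) , +-monoʳ-< (j * t) (s≤s c<c'))
  ...   | inj₂ refl = ⊥-elim (a≢b refl)

  rowWord : ℕ → List ℕ
  rowWord q = map (q * t +_) (range1 t)

  readingWord : ℕ → List ℕ
  readingWord zero = []
  readingWord (suc q) = rowWord q ++ readingWord q

  rowWord-row : ∀ {x} q → x ∈ rowWord q → row x ≡ q
  rowWord-row q x∈ with ∈-map⁻ (q * t +_) x∈
  ... | _ , c∈ , refl with ∈-range1⁻ t c∈
  ...   | s≤s z≤n , c<t = row-cell q c<t

  readingWord-row : ∀ {x} q → x ∈ readingWord q → row x < q
  readingWord-row (suc q) x∈ with ∈-++⁻ (rowWord q) x∈
  ... | inj₁ x∈row = ≤-reflexive (cong suc (rowWord-row q x∈row))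
  ... | inj₂ x∈rest = m<n⇒m<1+n (readingWord-row q x∈rest)

  rowWord-sorted : ∀ q → AllPairs _◁_ (rowWord q)
  rowWord-sorted q = AllPairs.map⁺
    (allPairs-mapWithAll same-row (All.tabulate (∈-range1⁻ t)) (range1-increasing t))
    where
    same-row : ∀ {x y} → 1 ≤ x × x ≤ t → 1 ≤ y × y ≤ t → x < y → (q * t + x) ◁ (q * t + y)
    same-row {suc c} {suc d} (_ , c<t) (_ , d<t) x<y =
      inj₂ (trans (row-cell q c<t) (sym (row-cell q d<t)) , +-monoʳ-< (q * t) x<y)

  readingWord-sorted : ∀ q → AllPairs _◁_ (readingWord q)
  readingWord-sorted zero = []
  readingWord-sorted (suc q) = AllPairs.++⁺ (rowWord-sorted q) (readingWord-sorted q)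
    (All.tabulate λ x∈ → All.tabulate λ {y} y∈ →
      inj₁ (subst (row y <_) (sym (rowWord-row q x∈)) (readingWord-row q y∈)))

  readingWord-↭ : ∀ q → readingWord q ↭ range1 (q * t)
  readingWord-↭ zero = ↭-refl
  readingWord-↭ (suc q) =
    ↭-trans (++-comm (rowWord q) (readingWord q))
      (↭-trans (++⁺ʳ (rowWord q) (readingWord-↭ q)) (↭-reflexive (sym range1-suc)))
    where
    range1-suc : range1 (suc q * t) ≡ range1 (q * t) ++ rowWord q
    range1-suc = trans (cong range1 (+-comm t (q * t))) (range1-+ (q * t) t)

  readingWord-linearExtension : IsLinearExtension (s * t) (EN≼ s t) (readingWord s)
  readingWord-linearExtension = readingWord-↭ s , before
    where
    ∈readingWord : ∀ {x} → x ∈ range1 (s * t) → x ∈ readingWord s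
    ∈readingWord = ∈-resp-↭ (↭-sym (readingWord-↭ s))

    before : ∀ a b → EN≼ s t a b → a ≢ b → AppearsBefore (readingWord s) a b
    before _ _ a≼b@(suc j , suc c , suc j' , suc c' , (_ , j<s , _ , c<t , _ , j'<s , _ , c'<t) ,
                    refl , refl , _) a≢b =
      sorted⇒appearsBefore (readingWord-sorted s)
        (∈readingWord (cell∈range j<s c<t)) (∈readingWord (cell∈range j'<s c'<t)) (≼⇒◁ a≼b a≢b)

  -- A 213 at positions i < j < k would need row π(j) < row π(i) ≤ row π(k) ≤ row π(j).
  readingWord-avoids213 : Avoids213 (readingWord s)
  readingWord-avoids213 (i , j , k , i<j , j<k , πj<πi , πi<πk) =
    <-irrefl refl (≤-<-trans (row-mono (<⇒≤ πi<πk))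
                  (≤-<-trans (◁⇒row≥ (lookup-sorted sorted j<k))
                             (◁-downwards (lookup-sorted sorted i<j) πj<πi)))
    where
    sorted : AllPairs _◁_ (readingWord s)
    sorted = readingWord-sorted s

  linearExtension⇒respectsOrder : ∀ {σ} → IsLinearExtension (s * t) (EN≼ s t) σ → Avoids213 σ →
                                  RespectsOrder σ
  linearExtension⇒respectsOrder {σ} (σ↭ , extends) avoids {a} {b} a∈σ b∈σ a◁b = by-rows a◁b
    where
    a∈ : a ∈ range1 (s * t)
    a∈ = ∈-resp-↭ σ↭ a∈σ
    b∈ : b ∈ range1 (s * t)
    b∈ = ∈-resp-↭ σ↭ b∈σ

    by-rows : a ◁ b → AppearsBefore σ a b
    by-rows (inj₂ (ra≡rb , a<b)) = extends a b (sameRow-≼ a∈ b∈ ra≡rb a<b) (<⇒≢ a<b)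
    by-rows (inj₁ rb<ra) =
      avoids213⇒appearsBefore avoids (extends x b (rowStart-≼ a∈ b∈ rb<ra) (>⇒≢ b<x)) b<x x≤a a∈σ
      where
      x : ℕ
      x = row a * t + 1
      b<x : b < x
      b<x = subst (_< x) (sym (cell-row-col b∈))
                  (≤-<-trans (m*t+e≤n*t rb<ra (col<t b)) (m<m+n (row a * t) (s≤s z≤n)))
      x≤a : x ≤ a
      x≤a = subst (x ≤_) (sym (cell-row-col a∈)) (+-monoʳ-≤ (row a * t) (s≤s z≤n))

  readingWord-unique : (σ : List ℕ) → EN213 s t σ → σ ≡ readingWord s
  readingWord-unique σ (extension@(σ↭ , _) , avoids) =
    sorted-↭⇒≡ (↭-trans σ↭ (↭-sym (readingWord-↭ s)))
      (respectsOrder⇒sorted (↭-unique (↭-sym σ↭) (range1-unique (s * t)))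
                            (linearExtension⇒respectsOrder extension avoids))
      (readingWord-sorted s)

theorem3p1 : (s t : ℕ) → 1 ≤ s → 1 ≤ t →
    Σ (List ℕ) λ π → EN213 s t π × ((σ : List ℕ) → EN213 s t σ → σ ≡ π)
theorem3p1 s t@(suc _) _ _ =
  readingWord s , (readingWord-linearExtension , readingWord-avoids213) , readingWord-unique
  where open Grid s t
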